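{- Let $p$ be a prime and $m\in\mathbb{N}$. Let $\boldsymbol{\eta}=(\eta_j)_{0\le j<p^m}$ be non-negative integers with $\eta_0=0$ and $\eta_j\le\eta_{j+1}\le\eta_j+1$, and let $\boldsymbol{u}=(u_j)_{0\le j<p^m}$ be integers with $u_j\not\equiv0\pmod p$. Let $k,t$ be integers with $0\le k<p^m$, $1\le t\le p^m$ and $k+t\le p^m-1$. Then, with the notation of the context, (1) $c^{(\boldsymbol{\eta},\boldsymbol{u})}_{k+t,t}\equiv \xi_t\cdot A^{(\boldsymbol{\eta},\boldsymbol{u})}_{k,t}\pmod p$; (2) $d^{(\boldsymbol{\eta},\boldsymbol{u})}_{k+t,t}\equiv \xi_t\cdot B^{(\boldsymbol{\eta},\boldsymbol{u})}_{k,t}+c^{(\boldsymbol{\eta}^{(t)},\boldsymbol{u}^{(t)})}_{k+t,p^m-t}\pmod p$, where $\boldsymbol{\eta}^{(t)}=(\eta_t,\eta_{t+1},\ldots,\eta_{p^m-1})$ and $\boldsymbol{u}^{(t)}=(u_t,u_{t+1},\ldots,u_{p^m-1})$.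
   Context: Binomial coefficients $\binom{n}{r}$ with $n\ge0$ are $0$ if $r<0$ or $r>n$. For $t\ge1$ let $\xi_t$ be the row vector $\left((-1)^{t+1}\binom{t}{0},(-1)^{t+2}\binom{t}{1},\ldots,(-1)^{2t}\binom{t}{t-1}\right)$, i.e. $(\xi_t)_i=(-1)^{t+i+1}\binom{t}{i}$ for $0\le i\le t-1$. For sequences $\boldsymbol{\eta},\boldsymbol{u}$ (indexed from $0$): $A^{(\boldsymbol{\eta},\boldsymbol{u})}_{k,t}=\left(\binom{i+j-\eta_j}{j}u_j\right)_{i=k,\ldots,k+t-1,\ j=0,\ldots,t-1}$ (a $t\times t$ matrix); $B^{(\boldsymbol{\eta},\boldsymbol{u})}_{k,t}=\left(\binom{i+j-\eta_j}{j}u_j\right)_{i=k,\ldots,k+t-1,\ j=t,\ldots,p^m-1}$; for integers $s\ge0$ and $r\ge1$, $c^{(\boldsymbol{\eta},\boldsymbol{u})}_{s,r}=\left(\binom{s+j-\eta_j}{j}u_j\right)_{j=0,\ldots,r-1}$ (row vector); and $d^{(\boldsymbol{\eta},\boldsymbol{u})}_{k+t,t}=\left(\binom{k+t+j-\eta_j}{j}u_j\right)_{j=t,\ldots,p^m-1}$ (row vector). Thus $c^{(\boldsymbol{\eta}^{(t)},\boldsymbol{u}^{(t)})}_{k+t,p^m-t}=\left(\binom{k+t+j-\eta_{t+j}}{j}u_{t+j}\right)_{j=0,\ldots,p^m-t-1}$. -}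

module Defs where

open import Data.Nat using (ℕ; zero; suc; _+_; _∸_)
open import Data.Nat.Combinatorics using (_C_)
open import Data.Integer as ℤ using (ℤ; +_; -_; _-_)
open import Data.Integer.Divisibility using (_∣_)

_≡_[mod_] : ℤ → ℤ → ℕ → Set
a ≡ b [mod p ] = (+ p) ∣ (a - b)

Σ< : ℕ → (ℕ → ℤ) → ℤ
Σ< zero    f = + 0
Σ< (suc n) f = Σ< n f ℤ.+ f n

ξ : ℕ → ℕ → ℤ
ξ t i = ((- + 1) ℤ.^ (t + i + 1)) ℤ.* (+ (t C i))

-- the common entry  binom(i + j - η_j, j) * u_j  (row index i, column index j).
-- Under the hypotheses η_j ≤ j, so the truncated subtraction is exact.
entry : (ℕ → ℕ) → (ℕ → ℤ) → ℕ → ℕ → ℤ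
entry η u i j = (+ ((i + j ∸ η j) C j)) ℤ.* u j

-- A_{k,t}: rows i = k..k+t-1, columns j = 0..t-1; indexed by (row offset r, column j)
A : (ℕ → ℕ) → (ℕ → ℤ) → ℕ → ℕ → ℕ → ℕ → ℤ
A η u k t r j = entry η u (k + r) j

-- B_{k,t}: rows i = k..k+t-1, columns j = t..p^m-1; indexed by (row offset r, actual column j)
B : (ℕ → ℕ) → (ℕ → ℤ) → ℕ → ℕ → ℕ → ℕ → ℤ
B η u k t r j = entry η u (k + r) j

-- c_{s,r}: the row vector (entry η u s j)_{j=0..r-1}
c : (ℕ → ℕ) → (ℕ → ℤ) → ℕ → ℕ → ℤ
c η u s j = entry η u s j

-- d_{k+t,t}: the row vector (entry η u (k+t) j)_{j=t..p^m-1}, indexed by actual column j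
d : (ℕ → ℕ) → (ℕ → ℤ) → ℕ → ℕ → ℕ → ℤ
d η u k t j = entry η u (k + t) j

ξ· : ℕ → (ℕ → ℕ → ℤ) → ℕ → ℤ
ξ· t M j = Σ< t (λ r → ξ t r ℤ.* M r j)

shift : {X : Set} → ℕ → (ℕ → X) → ℕ → X
shift t s j = s (t + j)

-- The t-th forward difference Δᵗ f of a sequence satisfies f(t) = ξ_t · (f(0), …, f(t−1)) + Δᵗ f(0),
-- because ξ_t lists, up to sign, all binomial coefficients of Δᵗ except the leading one. Each column
-- of A and B is the sequence r ↦ binom(y + r, j) u_j with y = k + j − η_j, whose t-th difference
-- is binom(y, j − t) u_j: it vanishes for j < t, and for j ≥ t it is exactly the entry of the
-- shifted vector c^(η^(t), u^(t)). So both congruences are in fact equalities of integers.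
module Submission where

open import Defs
open import Data.Nat using (ℕ; zero; suc; _+_; _∸_; _^_; _≤_; _<_; z≤n; s≤s)
import Data.Nat.Properties as ℕₚ
open import Data.Nat.Combinatorics using (_C_; nCk+nC[k+1]≡[n+1]C[k+1]; nCn≡1)
open import Data.Nat.Divisibility using (_∣0)
open import Data.Nat.Primality using (Prime)
open import Data.Integer as ℤ using (ℤ; +_; -_; _-_; _*_; -1ℤ) renaming (_+_ to _⊕_)
import Data.Integer.Properties as ℤₚ
open import Data.Integer.Tactic.RingSolver using (solve-∀)
open import Data.Product using (_×_; _,_; proj₂)
open import Data.Sum using (inj₁; inj₂)
open import Function using (_∘_)
open import Relation.Nullary using (¬_)
open import Relation.Binary.PropositionalEquality
  using (_≡_; refl; sym; trans; cong; cong₂; module ≡-Reasoning)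

≡⇒≡[mod] : ∀ p {a b} → a ≡ b → a ≡ b [mod p ]
≡⇒≡[mod] p a≡b rewrite ℤₚ.i≡j⇒i-j≡0 a≡b = p ∣0

Σ<-cong : ∀ n {f g : ℕ → ℤ} → (∀ i → f i ≡ g i) → Σ< n f ≡ Σ< n g
Σ<-cong zero    f≗g = refl
Σ<-cong (suc n) f≗g = cong₂ _⊕_ (Σ<-cong n f≗g) (f≗g n)

Σ<-distrib-- : ∀ n (f g : ℕ → ℤ) → Σ< n (λ i → f i - g i) ≡ Σ< n f - Σ< n g
Σ<-distrib-- zero    f g = refl
Σ<-distrib-- (suc n) f g =
  trans (cong (_⊕ (f n - g n)) (Σ<-distrib-- n f g)) (regroup (Σ< n f) (Σ< n g) (f n) (g n))
  where
  regroup : ∀ a b c d → (a - b) ⊕ (c - d) ≡ (a ⊕ c) - (b ⊕ d)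
  regroup = solve-∀

Σ<-shift : ∀ n (f : ℕ → ℤ) → Σ< (suc n) f ≡ f 0 ⊕ Σ< n (f ∘ suc)
Σ<-shift zero    f = ℤₚ.+-comm (+ 0) (f 0)
Σ<-shift (suc n) f = trans (cong (_⊕ f (suc n)) (Σ<-shift n f)) (ℤₚ.+-assoc (f 0) _ _)

*-distribʳ-- : ∀ a b v → (a - b) * v ≡ a * v - b * v
*-distribʳ-- = solve-∀

-1^-suc : ∀ n → (- + 1) ℤ.^ suc n ≡ - ((- + 1) ℤ.^ n)
-1^-suc n = ℤₚ.-1*i≡-i _

ξ-head : ∀ t → ξ (suc t) 0 ≡ - ξ t 0
ξ-head t rewrite ℕₚ.+-identityʳ t =
  trans (cong (_* + 1) (-1^-suc (t + 1))) (sym (ℤₚ.neg-distribˡ-* ((- + 1) ℤ.^ (t + 1)) (+ 1)))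

ξ-diag : ∀ t → ξ t t ≡ -1ℤ
ξ-diag t = begin
  (- + 1) ℤ.^ (t + t + 1) * + (t C t)
    ≡⟨ cong₂ (λ e n → (- + 1) ℤ.^ e * + n) (ℕₚ.+-comm (t + t) 1) (nCn≡1 t) ⟩
  (- + 1) ℤ.^ suc (t + t) * + 1        ≡⟨ ℤₚ.*-identityʳ _ ⟩
  (- + 1) ℤ.^ suc (t + t)              ≡⟨ -1^-suc (t + t) ⟩
  - ((- + 1) ℤ.^ (t + t))              ≡⟨ cong -_ (even t) ⟩
  -1ℤ                                  ∎
  where
  open ≡-Reasoning
  even : ∀ t → (- + 1) ℤ.^ (t + t) ≡ + 1
  even zero    = refl
  even (suc t) rewrite ℕₚ.+-suc t t | -1^-suc (suc (t + t)) | -1^-suc (t + t) | even t = refl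

ξ-pascal : ∀ t r → ξ (suc t) (suc r) ≡ ξ t r - ξ t (suc r)
ξ-pascal t r
  rewrite ℕₚ.+-suc t r
        | sym (nCk+nC[k+1]≡[n+1]C[k+1] t r)
        | -1^-suc (suc (t + r + 1))
        | -1^-suc (t + r + 1)
        | ℤₚ.pos-+ (t C r) (t C suc r)
        = signs ((- + 1) ℤ.^ (t + r + 1)) (+ (t C r)) (+ (t C suc r))
  where
  signs : ∀ s a b → (- - s) * (a ⊕ b) ≡ s * a - (- s) * b
  signs = solve-∀

Δ : ℕ → (ℕ → ℤ) → ℤ
Δ zero    f = f 0
Δ (suc t) f = Δ t (f ∘ suc) - Δ t f

Δ-cong : ∀ t {f g : ℕ → ℤ} → (∀ r → f r ≡ g r) → Δ t f ≡ Δ t g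
Δ-cong zero    f≗g = f≗g 0
Δ-cong (suc t) f≗g = cong₂ _-_ (Δ-cong t (f≗g ∘ suc)) (Δ-cong t f≗g)

Δ-*ʳ : ∀ t (f : ℕ → ℤ) v → Δ t (λ r → f r * v) ≡ Δ t f * v
Δ-*ʳ zero    f v = refl
Δ-*ʳ (suc t) f v =
  trans (cong₂ _-_ (Δ-*ʳ t (f ∘ suc) v) (Δ-*ʳ t f v)) (sym (*-distribʳ-- (Δ t (f ∘ suc)) (Δ t f) v))

ξ-sum-suc : ∀ t (f : ℕ → ℤ) →
  Σ< (suc t) (λ r → ξ (suc t) r * f r) ≡ Σ< t (λ r → ξ t r * f (suc r)) ⊕ f t - Σ< t (λ r → ξ t r * f r)
ξ-sum-suc t f = begin
  Σ< (suc t) (λ r → ξ (suc t) r * f r)                ≡⟨ Σ<-shift t _ ⟩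
  ξ (suc t) 0 * f 0 ⊕ Σ< t (λ r → ξ (suc t) (suc r) * f (suc r))
    ≡⟨ cong₂ _⊕_ (cong (_* f 0) (ξ-head t)) (Σ<-cong t λ r → cong (_* f (suc r)) (ξ-pascal t r)) ⟩
  - ξ t 0 * f 0 ⊕ Σ< t (λ r → (ξ t r - ξ t (suc r)) * f (suc r))
    ≡⟨ cong (- ξ t 0 * f 0 ⊕_) (Σ<-cong t λ r → *-distribʳ-- (ξ t r) (ξ t (suc r)) (f (suc r))) ⟩
  - ξ t 0 * f 0 ⊕ Σ< t (λ r → ξ t r * f (suc r) - ξ t (suc r) * f (suc r))
    ≡⟨ cong (- ξ t 0 * f 0 ⊕_) (Σ<-distrib-- t _ _) ⟩
  - ξ t 0 * f 0 ⊕ (S′ - T)                           ≡⟨ regroup (ξ t 0) (f 0) S′ T ⟩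
  S′ - (ξ t 0 * f 0 ⊕ T)
    ≡⟨ cong (λ x → S′ - x) (sym (Σ<-shift t (λ r → ξ t r * f r))) ⟩
  S′ - (S ⊕ ξ t t * f t)                              ≡⟨ cong (λ x → S′ - (S ⊕ x * f t)) (ξ-diag t) ⟩
  S′ - (S ⊕ -1ℤ * f t)                                ≡⟨ regroup′ S′ S (f t) ⟩
  S′ ⊕ f t - S                                        ∎
  where
  open ≡-Reasoning
  S S′ T : ℤ
  S  = Σ< t (λ r → ξ t r * f r)
  S′ = Σ< t (λ r → ξ t r * f (suc r))
  T  = Σ< t (λ r → ξ t (suc r) * f (suc r))
  regroup : ∀ x y a b → - x * y ⊕ (a - b) ≡ a - (x * y ⊕ b)
  regroup = solve-∀
  regroup′ : ∀ a b c → a - (b ⊕ -1ℤ * c) ≡ a ⊕ c - b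
  regroup′ = solve-∀

ξ-expansion : ∀ t (f : ℕ → ℤ) → f t ≡ Σ< t (λ r → ξ t r * f r) ⊕ Δ t f
ξ-expansion zero    f = sym (ℤₚ.+-identityˡ (f 0))
ξ-expansion (suc t) f = begin
  f (suc t)                       ≡⟨ ξ-expansion t (f ∘ suc) ⟩
  S′ ⊕ Δ t (f ∘ suc)              ≡⟨ regroup S′ S (Δ t f) (Δ t (f ∘ suc)) ⟩
  (S′ ⊕ (S ⊕ Δ t f) - S) ⊕ Δ (suc t) f
    ≡⟨ cong (λ x → (S′ ⊕ x - S) ⊕ Δ (suc t) f) (sym (ξ-expansion t f)) ⟩
  (S′ ⊕ f t - S) ⊕ Δ (suc t) f   ≡⟨ cong (_⊕ Δ (suc t) f) (sym (ξ-sum-suc t f)) ⟩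
  Σ< (suc t) (λ r → ξ (suc t) r * f r) ⊕ Δ (suc t) f ∎
  where
  open ≡-Reasoning
  S S′ : ℤ
  S  = Σ< t (λ r → ξ t r * f r)
  S′ = Σ< t (λ r → ξ t r * f (suc r))
  regroup : ∀ a b d d′ → a ⊕ d′ ≡ (a ⊕ (b ⊕ d) - b) ⊕ (d′ - d)
  regroup = solve-∀

pascal-difference : ∀ y i → + (suc y C suc i) - + (y C suc i) ≡ + (y C i)
pascal-difference y i = begin
  + (suc y C suc i) - + (y C suc i)
    ≡⟨ cong (λ x → + x - + (y C suc i)) (sym (nCk+nC[k+1]≡[n+1]C[k+1] y i)) ⟩
  + (y C i + y C suc i) - + (y C suc i)        ≡⟨ cong (_- + (y C suc i)) (ℤₚ.pos-+ (y C i) (y C suc i)) ⟩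
  (+ (y C i) ⊕ + (y C suc i)) - + (y C suc i)  ≡⟨ +-cancelʳ (+ (y C i)) (+ (y C suc i)) ⟩
  + (y C i)                                    ∎
  where
  open ≡-Reasoning
  +-cancelʳ : ∀ a b → (a ⊕ b) - b ≡ a
  +-cancelʳ = solve-∀

Δ-binomial-shift : ∀ t j y → Δ t (λ r → + ((y + suc r) C j)) ≡ Δ t (λ r → + ((suc y + r) C j))
Δ-binomial-shift t j y = Δ-cong t λ r → cong (λ x → + (x C j)) (ℕₚ.+-suc y r)

Δ-binomial : ∀ t i y → Δ t (λ r → + ((y + r) C (t + i))) ≡ + (y C i)
Δ-binomial zero    i y = cong (λ x → + (x C i)) (ℕₚ.+-identityʳ y)
Δ-binomial (suc t) i y = begin
  Δ t (λ r → + ((y + suc r) C suc (t + i))) - Δ t (λ r → + ((y + r) C suc (t + i)))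
    ≡⟨ cong (λ x → Δ t (λ r → + ((y + suc r) C x)) - Δ t (λ r → + ((y + r) C x)))
            (sym (ℕₚ.+-suc t i)) ⟩
  Δ t (λ r → + ((y + suc r) C (t + suc i))) - Δ t (λ r → + ((y + r) C (t + suc i)))
    ≡⟨ cong (_- Δ t (λ r → + ((y + r) C (t + suc i)))) (Δ-binomial-shift t (t + suc i) y) ⟩
  Δ t (λ r → + ((suc y + r) C (t + suc i))) - Δ t (λ r → + ((y + r) C (t + suc i)))
    ≡⟨ cong₂ _-_ (Δ-binomial t (suc i) (suc y)) (Δ-binomial t (suc i) y) ⟩
  + (suc y C suc i) - + (y C suc i)
    ≡⟨ pascal-difference y i ⟩
  + (y C i) ∎
  where open ≡-Reasoning

Δ-binomial-diag : ∀ j y → Δ j (λ r → + ((y + r) C j)) ≡ + 1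
Δ-binomial-diag j y =
  trans (Δ-cong j λ r → cong (λ i → + ((y + r) C i)) (sym (ℕₚ.+-identityʳ j))) (Δ-binomial j 0 y)

Δ-binomial-< : ∀ t j y → j < t → Δ t (λ r → + ((y + r) C j)) ≡ + 0
Δ-binomial-< (suc t) j y (s≤s j≤t) with ℕₚ.m≤n⇒m<n∨m≡n j≤t
... | inj₁ j<t  = cong₂ _-_ (trans (Δ-binomial-shift t j y) (Δ-binomial-< t j (suc y) j<t))
                            (Δ-binomial-< t j y j<t)
... | inj₂ refl = cong₂ _-_ (trans (Δ-binomial-shift j j y) (Δ-binomial-diag j (suc y)))
                            (Δ-binomial-diag j y)

steps≤1⇒≤id : ∀ P (η : ℕ → ℕ) → η 0 ≡ 0 → (∀ j → j + 1 < P → η (j + 1) ≤ η j + 1) →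
              ∀ j → j < P → η j ≤ j
steps≤1⇒≤id P η η0≡0 step zero    _ rewrite η0≡0 = z≤n
steps≤1⇒≤id P η η0≡0 step (suc j) j<P = begin
  η (suc j)  ≡⟨ cong η (ℕₚ.+-comm 1 j) ⟩
  η (j + 1)  ≤⟨ step j (ℕₚ.≤-trans (ℕₚ.≤-reflexive (cong suc (ℕₚ.+-comm j 1))) j<P) ⟩
  η j + 1    ≤⟨ ℕₚ.+-monoˡ-≤ 1 (steps≤1⇒≤id P η η0≡0 step j (ℕₚ.<-trans (ℕₚ.n<1+n j) j<P)) ⟩
  j + 1      ≡⟨ ℕₚ.+-comm j 1 ⟩
  suc j      ∎
  where open ℕₚ.≤-Reasoning

entry-column : ∀ η u k r j → η j ≤ j → entry η u (k + r) j ≡ + ((k + (j ∸ η j) + r) C j) * u j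
entry-column η u k r j ηj≤j = cong (λ x → + (x C j) * u j) (begin
  k + r + j ∸ η j      ≡⟨ ℕₚ.+-∸-assoc (k + r) ηj≤j ⟩
  k + r + (j ∸ η j)    ≡⟨ ℕₚ.+-assoc k r (j ∸ η j) ⟩
  k + (r + (j ∸ η j))  ≡⟨ cong (λ x → k + x) (ℕₚ.+-comm r (j ∸ η j)) ⟩
  k + (j ∸ η j + r)    ≡⟨ ℕₚ.+-assoc k (j ∸ η j) r ⟨
  k + (j ∸ η j) + r    ∎)
  where open ≡-Reasoning

entry-ξ-expansion : ∀ η u k t j → η j ≤ j →
  entry η u (k + t) j ≡
    Σ< t (λ r → ξ t r * entry η u (k + r) j) ⊕ Δ t (λ r → + ((k + (j ∸ η j) + r) C j)) * u j
entry-ξ-expansion η u k t j ηj≤j = begin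
  entry η u (k + t) j                          ≡⟨ entry-column η u k t j ηj≤j ⟩
  column t                                     ≡⟨ ξ-expansion t column ⟩
  Σ< t (λ r → ξ t r * column r) ⊕ Δ t column
    ≡⟨ cong₂ _⊕_ (Σ<-cong t λ r → cong (ξ t r *_) (sym (entry-column η u k r j ηj≤j)))
                 (Δ-*ʳ t (λ r → + ((k + (j ∸ η j) + r) C j)) (u j)) ⟩
  Σ< t (λ r → ξ t r * entry η u (k + r) j) ⊕ Δ t (λ r → + ((k + (j ∸ η j) + r) C j)) * u j ∎
  where
  open ≡-Reasoning
  column : ℕ → ℤ
  column r = + ((k + (j ∸ η j) + r) C j) * u j

shifted-entry : ∀ η u k t i → η (t + i) ≤ t + i →
  c (shift t η) (shift t u) (k + t) i ≡ + ((k + (t + i ∸ η (t + i))) C i) * u (t + i)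
shifted-entry η u k t i ηj≤j = cong (λ x → + (x C i) * u (t + i))
  (trans (cong (_∸ η (t + i)) (ℕₚ.+-assoc k t i)) (ℕₚ.+-∸-assoc k ηj≤j))

c≡ξ·A : ∀ η u k t j → η j ≤ j → j < t → c η u (k + t) j ≡ ξ· t (A η u k t) j
c≡ξ·A η u k t j ηj≤j j<t = begin
  entry η u (k + t) j      ≡⟨ entry-ξ-expansion η u k t j ηj≤j ⟩
  ξ· t (A η u k t) j ⊕ Δ t (λ r → + ((k + (j ∸ η j) + r) C j)) * u j
    ≡⟨ cong (λ x → ξ· t (A η u k t) j ⊕ x * u j) (Δ-binomial-< t j (k + (j ∸ η j)) j<t) ⟩
  ξ· t (A η u k t) j ⊕ + 0 * u j ≡⟨ ℤₚ.+-identityʳ _ ⟩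
  ξ· t (A η u k t) j       ∎
  where open ≡-Reasoning

d≡ξ·B+c : ∀ η u k t i → η (t + i) ≤ t + i →
  d η u k t (t + i) ≡ ξ· t (B η u k t) (t + i) ⊕ c (shift t η) (shift t u) (k + t) i
d≡ξ·B+c η u k t i ηj≤j = begin
  entry η u (k + t) (t + i)  ≡⟨ entry-ξ-expansion η u k t (t + i) ηj≤j ⟩
  ξ· t (B η u k t) (t + i) ⊕ Δ t (λ r → + ((y + r) C (t + i))) * u (t + i)
    ≡⟨ cong (λ x → ξ· t (B η u k t) (t + i) ⊕ x * u (t + i)) (Δ-binomial t i y) ⟩
  ξ· t (B η u k t) (t + i) ⊕ + (y C i) * u (t + i)
    ≡⟨ cong (ξ· t (B η u k t) (t + i) ⊕_) (sym (shifted-entry η u k t i ηj≤j)) ⟩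
  ξ· t (B η u k t) (t + i) ⊕ c (shift t η) (shift t u) (k + t) i ∎
  where
  open ≡-Reasoning
  y : ℕ
  y = k + (t + i ∸ η (t + i))

lemma7 : (p m : ℕ) → Prime p →
    (η : ℕ → ℕ) → (u : ℕ → ℤ) →
    η 0 ≡ 0 →
    (∀ j → j + 1 < p ^ m → (η j ≤ η (j + 1)) × (η (j + 1) ≤ η j + 1)) →
    (∀ j → j < p ^ m → ¬ (u j ≡ + 0 [mod p ])) →
    (k t : ℕ) → k < p ^ m → 1 ≤ t → t ≤ p ^ m → k + t ≤ p ^ m ∸ 1 →
    (∀ j → j < t →
      c η u (k + t) j ≡ ξ· t (A η u k t) j [mod p ])
    ×
    (∀ j → t ≤ j → j < p ^ m →
      d η u k t j ≡ ξ· t (B η u k t) j ℤ.+ c (shift t η) (shift t u) (k + t) (j ∸ t) [mod p ])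
lemma7 p m _ η u η0≡0 steps _ k t _ _ t≤pᵐ _ = columns-below-t , columns-from-t
  where
  η-sublinear : ∀ j → j < p ^ m → η j ≤ j
  η-sublinear = steps≤1⇒≤id (p ^ m) η η0≡0 (λ j → proj₂ ∘ steps j)

  columns-below-t : ∀ j → j < t → c η u (k + t) j ≡ ξ· t (A η u k t) j [mod p ]
  columns-below-t j j<t =
    ≡⇒≡[mod] p (c≡ξ·A η u k t j (η-sublinear j (ℕₚ.<-≤-trans j<t t≤pᵐ)) j<t)

  columns-from-t : ∀ j → t ≤ j → j < p ^ m →
    d η u k t j ≡ ξ· t (B η u k t) j ⊕ c (shift t η) (shift t u) (k + t) (j ∸ t) [mod p ]
  columns-from-t j t≤j j<pᵐ with ℕₚ.m≤n⇒∃[o]m+o≡n t≤j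
  ... | i , refl rewrite ℕₚ.m+n∸m≡n t i =
    ≡⇒≡[mod] p (d≡ξ·B+c η u k t i (η-sublinear (t + i) j<pᵐ))
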